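{- Let $D$ be a strongly connected digraph with girth $g$, and let $k$ and $p$ be integers with $k\geq g-1\geq p\geq 1$. Let $\hat{k}=\lceil k/p\rceil\, p$. If $D$ contains no directed cycle whose length is congruent to $r$ modulo $\hat{k}$ for any $r\in\{ -p+2,\ldots,0,\ldots,p\}$, then $\chi_A(D)\leq \lceil k/p\rceil$.
   Context: All digraphs are finite and loopless; cycles are directed cycles. The girth of a digraph is the length of a shortest directed cycle. A digraph is strongly connected if for every ordered pair of distinct vertices $u,v$ there is a directed path from $u$ to $v$. A set of vertices is acyclic if it induces a subdigraph with no directed cycle; the dichromatic number $\chi_A(D)$ is the minimum number of colors in a vertex coloring of $D$ in which every color class is acyclic. -}

module Defs where

open import Data.Nat using (ℕ; zero; suc; _+_; _*_; _≤_; _/_)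
open import Data.Fin using (Fin; zero; suc; inject₁; fromℕ)
open import Data.Product using (Σ; _×_; ∃)
open import Data.Empty using (⊥)
open import Relation.Nullary using (¬_)
open import Relation.Binary using (Decidable)
open import Relation.Binary.PropositionalEquality using (_≡_)
open import Relation.Binary.Construct.Closure.ReflexiveTransitive using (Star)
open import Function.Definitions using (Injective)
open import Data.Integer as ℤ using (ℤ; +_)
import Data.Integer.Divisibility as ℤD

record Digraph : Set₁ where
  field
    n        : ℕ
    Arc      : Fin n → Fin n → Set
    arc?     : Decidable Arc
    loopless : ∀ v → ¬ Arc v v

open Digraph public

-- A directed cycle of length (suc m), m ≥ 1: distinct vertices c₀,…,c_m with arcs
-- c_i → c_{i+1} and c_m → c₀.
record DirectedCycle (D : Digraph) (m : ℕ) : Set where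
  field
    vtx       : Fin (suc m) → Fin (n D)
    nontriv   : 1 ≤ m
    distinct  : Injective _≡_ _≡_ vtx
    step      : ∀ (i : Fin m) → Arc D (vtx (inject₁ i)) (vtx (suc i))
    close     : Arc D (vtx (fromℕ m)) (vtx zero)

HasCycleOfLength : Digraph → ℕ → Set
HasCycleOfLength D ℓ = Σ ℕ λ m → (ℓ ≡ suc m) × DirectedCycle D m

StronglyConnected : Digraph → Set
StronglyConnected D = ∀ (u v : Fin (n D)) → Star (Arc D) u v

IsGirth : Digraph → ℕ → Set
IsGirth D g = HasCycleOfLength D g × (∀ ℓ → HasCycleOfLength D ℓ → g ≤ ℓ)

-- Ceiling division ⌈k/p⌉ (junk value 0 for p = 0).
ceilDiv : ℕ → ℕ → ℕ
ceilDiv k zero    = 0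
ceilDiv k (suc q) = (k + q) / suc q

Acyclic : (D : Digraph) → (Fin (n D) → Set) → Set
Acyclic D S = ∀ m (C : DirectedCycle D m) → ¬ (∀ i → S (DirectedCycle.vtx C i))

DichromaticAtMost : Digraph → ℕ → Set
DichromaticAtMost D c =
  Σ (Fin (n D) → Fin c) λ col → ∀ (j : Fin c) → Acyclic D (λ v → col v ≡ j)

CongMod : ℕ → ℕ → ℤ → Set
CongMod K ℓ r = (+ K) ℤD.∣ ((+ ℓ) ℤ.- r)

-- Run a depth-first search from any vertex and let h v be the depth of v in the search tree,
-- which spans D by strong connectivity. Every directed cycle has a back arc u → w with w an
-- ancestor of u: the vertex of the cycle discovered first is entered from one of its descendants.
-- Colour v by ⌊(h v mod k̂) / p⌋ ∈ {0, …, ⌈k/p⌉ − 1}. If u and w had the same colour, the tree path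
-- from w to u closed by u → w would be a cycle of length h u − h w + 1 ≡ r (mod k̂), where
-- r = 1 + (h u mod k̂ mod p) − (h w mod k̂ mod p) lies in {2 − p, …, p}.
module Submission where

open import Defs
open import Data.Nat using (ℕ; _≤_; _∸_; _*_)
open import Data.Integer as ℤ using (ℤ; +_)
open import Data.Product using (_×_)
open import Relation.Nullary using (¬_)

open import Data.Nat using (zero; suc; _+_; _<_; s≤s; z≤n; NonZero; >-nonZero; _/_; _%_)
import Data.Nat.Properties as ℕ
open import Data.Nat.DivMod using (m≡m%n+[m/n]*n; m%n<n; m<n*o⇒m/o<n; n/n≡1; /-monoˡ-≤)
import Data.Integer.Properties as ℤ
open import Data.Integer.Divisibility.Signed using (divides; ∣m∣n⇒∣m-n; ∣⇒∣ᵤ) renaming (_∣_ to _∣ˢ_)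
open import Data.Integer.Tactic.RingSolver using (solve-∀)
open import Data.Fin using (Fin; zero; suc; inject₁; fromℕ; fromℕ<; toℕ; _≟_)
open import Data.Fin.Properties using (toℕ-injective; toℕ-fromℕ; toℕ-fromℕ<; all?; any?; ¬∀⟶∃¬)
open import Data.Fin.Subset using (Subset; _∈_; _∉_; _⊆_; _-_; ∣_∣; ⁅_⁆; ⊤)
open import Data.Fin.Subset.Properties
  using (_∈?_; ∈⊤; p─q⊆p; x∈p∧x≢y⇒x∈p-y; x∈p⇒∣p-x∣<∣p∣; p⊆q⇒∣p∣≤∣q∣)
import Data.Vec as Vec
open import Data.Vec.Functional using (updateAt)
open import Data.Vec.Functional.Properties using (updateAt-updates; updateAt-minimal)
open import Data.List using (List; []; _∷_; allFin)
import Data.List.Membership.Propositional as List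
open import Data.List.Membership.Propositional.Properties using (∈-allFin)
open import Data.List.Relation.Unary.Any using (here; there)
open import Data.Product using (Σ; ∃; ∃₂; _,_; proj₁; proj₂)
open import Data.Sum using (_⊎_; inj₁; inj₂)
open import Data.Unit using () renaming (⊤ to Unit)
open import Data.Empty using (⊥-elim)
open import Function using (_∘_)
open import Relation.Nullary using (yes; no; contradiction)
open import Relation.Binary.PropositionalEquality
open import Relation.Binary.Construct.Closure.ReflexiveTransitive using (Star; ε; _◅_)
import Relation.Binary.Construct.Closure.ReflexiveTransitive as Star

+-divMod : ∀ m n .{{_ : NonZero n}} → + m ≡ + (m % n) ℤ.+ + (m / n) ℤ.* + n
+-divMod m n = begin
  + m                                  ≡⟨ cong +_ (m≡m%n+[m/n]*n m n) ⟩
  + (m % n + m / n * n)                ≡⟨ ℤ.pos-+ (m % n) (m / n * n) ⟩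
  + (m % n) ℤ.+ + (m / n * n)          ≡⟨ cong (λ z → + (m % n) ℤ.+ z) (ℤ.pos-* (m / n) n) ⟩
  + (m % n) ℤ.+ + (m / n) ℤ.* + n      ∎
  where open ≡-Reasoning

n∣m-m%n : ∀ m n .{{_ : NonZero n}} → + n ∣ˢ + m ℤ.- + (m % n)
n∣m-m%n m n = divides (+ (m / n)) (begin
  + m ℤ.- + (m % n)                              ≡⟨ cong (ℤ._- + (m % n)) (+-divMod m n) ⟩
  + (m % n) ℤ.+ + (m / n) ℤ.* + n ℤ.- + (m % n)  ≡⟨ cancel (+ (m % n)) (+ (m / n) ℤ.* + n) ⟩
  + (m / n) ℤ.* + n                              ∎)
  where
  open ≡-Reasoning
  cancel : ∀ a b → a ℤ.+ b ℤ.- a ≡ b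
  cancel = solve-∀

m/p≡n/p⇒m-n≡m%p-n%p : ∀ m n p .{{_ : NonZero p}} → m / p ≡ n / p →
                      + m ℤ.- + n ≡ + (m % p) ℤ.- + (n % p)
m/p≡n/p⇒m-n≡m%p-n%p m n p m/p≡n/p = begin
  + m ℤ.- + n                                      ≡⟨ cong₂ ℤ._-_ (+-divMod m p) (+-divMod n p) ⟩
  + (m % p) ℤ.+ q ℤ.* + p ℤ.- (+ (n % p) ℤ.+ + (n / p) ℤ.* + p)
    ≡⟨ cong (λ z → + (m % p) ℤ.+ q ℤ.* + p ℤ.- (+ (n % p) ℤ.+ + z ℤ.* + p)) (sym m/p≡n/p) ⟩
  + (m % p) ℤ.+ q ℤ.* + p ℤ.- (+ (n % p) ℤ.+ q ℤ.* + p)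
    ≡⟨ cancel (+ (m % p)) (+ (n % p)) (q ℤ.* + p) ⟩
  + (m % p) ℤ.- + (n % p)                          ∎
  where
  open ≡-Reasoning
  q : ℤ
  q = + (m / p)
  cancel : ∀ x y z → x ℤ.+ z ℤ.- (y ℤ.+ z) ≡ x ℤ.- y
  cancel = solve-∀

congMod-of-sameQuotient : ∀ p K .{{_ : NonZero p}} .{{_ : NonZero K}} ℓ y →
  ((ℓ + y) % K) / p ≡ (y % K) / p →
  CongMod K (suc ℓ) (ℤ.1ℤ ℤ.+ + ((ℓ + y) % K % p) ℤ.- + (y % K % p))
congMod-of-sameQuotient p K ℓ y same =
  ∣⇒∣ᵤ (subst (+ K ∣ˢ_) rearrange (∣m∣n⇒∣m-n (n∣m-m%n (ℓ + y) K) (n∣m-m%n y K)))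
  where
  open ≡-Reasoning
  a b : ℕ
  a = (ℓ + y) % K
  b = y % K
  swap : ∀ x y a b → x ℤ.- a ℤ.- (y ℤ.- b) ≡ x ℤ.- y ℤ.- (a ℤ.- b)
  swap = solve-∀
  shift : ∀ l y → l ℤ.+ y ℤ.- y ≡ l
  shift = solve-∀
  unshift : ∀ l s t → l ℤ.- (s ℤ.- t) ≡ ℤ.1ℤ ℤ.+ l ℤ.- (ℤ.1ℤ ℤ.+ s ℤ.- t)
  unshift = solve-∀
  rearrange : + (ℓ + y) ℤ.- + a ℤ.- (+ y ℤ.- + b) ≡ + suc ℓ ℤ.- (ℤ.1ℤ ℤ.+ + (a % p) ℤ.- + (b % p))
  rearrange = begin
    + (ℓ + y) ℤ.- + a ℤ.- (+ y ℤ.- + b)      ≡⟨ swap (+ (ℓ + y)) (+ y) (+ a) (+ b) ⟩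
    + (ℓ + y) ℤ.- + y ℤ.- (+ a ℤ.- + b)      ≡⟨ cong₂ ℤ._-_ (trans (cong (ℤ._- + y) (ℤ.pos-+ ℓ y)) (shift (+ ℓ) (+ y)))
                                                             (m/p≡n/p⇒m-n≡m%p-n%p a b p same) ⟩
    + ℓ ℤ.- (+ (a % p) ℤ.- + (b % p))        ≡⟨ unshift (+ ℓ) (+ (a % p)) (+ (b % p)) ⟩
    + suc ℓ ℤ.- (ℤ.1ℤ ℤ.+ + (a % p) ℤ.- + (b % p)) ∎

offset-bounds : ∀ {p s t} → s < p → t < p →
                + 2 ℤ.- + p ℤ.≤ ℤ.1ℤ ℤ.+ + s ℤ.- + t × ℤ.1ℤ ℤ.+ + s ℤ.- + t ℤ.≤ + p
offset-bounds {p} {s} {t} s<p t<p = lower , upper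
  where
  r≡ : ℤ.1ℤ ℤ.+ + s ℤ.- + t ≡ suc s ℤ.⊖ t
  r≡ = ℤ.m-n≡m⊖n (suc s) t
  upper : ℤ.1ℤ ℤ.+ + s ℤ.- + t ℤ.≤ + p
  upper = subst (ℤ._≤ + p) (sym r≡) (ℤ.≤-trans (ℤ.m⊖n≤m (suc s) t) (ℤ.+≤+ s<p))
  lower : + 2 ℤ.- + p ℤ.≤ ℤ.1ℤ ℤ.+ + s ℤ.- + t
  lower = subst₂ ℤ._≤_ (sym (ℤ.m-n≡m⊖n 2 p)) (sym r≡)
            (ℤ.≤-trans (ℤ.⊖-monoʳ-≥-≤ 2 t<p)
              (subst (ℤ._≤ suc s ℤ.⊖ t) (sym (ℤ.[1+m]⊖[1+n]≡m⊖n 1 t)) (ℤ.⊖-monoˡ-≤ t (s≤s z≤n))))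

block : ∀ p c .{{_ : NonZero p}} .{{_ : NonZero (c * p)}} → ℕ → Fin c
block p c x = fromℕ< (m<n*o⇒m/o<n (m%n<n x (c * p)))

sameBlock⇒congMod : ∀ p c .{{_ : NonZero p}} .{{_ : NonZero (c * p)}} ℓ y →
  block p c (ℓ + y) ≡ block p c y →
  Σ ℤ λ r → + 2 ℤ.- + p ℤ.≤ r × r ℤ.≤ + p × CongMod (c * p) (suc ℓ) r
sameBlock⇒congMod p c ℓ y same with offset-bounds (m%n<n ((ℓ + y) % (c * p)) p) (m%n<n (y % (c * p)) p)
... | lower , upper = _ , lower , upper , congMod-of-sameQuotient p (c * p) ℓ y quotients
  where
  quotients : ((ℓ + y) % (c * p)) / p ≡ (y % (c * p)) / p
  quotients = trans (sym (toℕ-fromℕ< _)) (trans (cong toℕ same) (toℕ-fromℕ< _))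

ceilDiv-nonZero : ∀ {k p} → 1 ≤ p → p ≤ k → NonZero (ceilDiv k p)
ceilDiv-nonZero {k} {suc q} _ p≤k =
  >-nonZero (subst (_≤ (k + q) / suc q) (n/n≡1 (suc q)) (/-monoˡ-≤ (suc q) (ℕ.≤-trans p≤k (ℕ.m≤m+n k q))))

module _ {a} {X : Set a} (Q : X → Set) where

  propagate-from-zero : ∀ {m} (f : Fin (suc m) → X) →
    (∀ j → Q (f (inject₁ j)) → Q (f (suc j))) → Q (f zero) → ∀ j → Q (f j)
  propagate-from-zero f next q zero = q
  propagate-from-zero {suc m} f next q (suc j) =
    next j (propagate-from-zero (f ∘ inject₁) (next ∘ inject₁) q j)

  propagate-to-last : ∀ {m} (f : Fin (suc m) → X) →
    (∀ j → Q (f (inject₁ j)) → Q (f (suc j))) → ∀ i → Q (f i) → Q (f (fromℕ m))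
  propagate-to-last {zero} f next zero q = q
  propagate-to-last {suc m} f next zero q = propagate-to-last (f ∘ suc) (next ∘ suc) zero (next zero q)
  propagate-to-last {suc m} f next (suc i) q = propagate-to-last (f ∘ suc) (next ∘ suc) i q

x∉p-x : ∀ {n} (p : Subset n) x → x ∉ p - x
x∉p-x (_ Vec.∷ p) zero ()
x∉p-x (_ Vec.∷ p) (suc x) (Vec.there x∈) = x∉p-x p x x∈

module DepthFirst (D : Digraph) where

  open DirectedCycle

  V : Set
  V = Fin (n D)

  record Rise (h : V → ℕ) (P : V → Set) (x y : V) : Set where
    constructor rise
    field
      src    : P x
      tgt    : P y
      arc    : Arc D x y
      height : h y ≡ suc (h x)

  -- A path of a search tree: h is the depth, and P contains every vertex of the path.
  LayeredPath : (V → ℕ) → (V → Set) → V → V → Set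
  LayeredPath h P = Star (Rise h P)

  module _ {h : V → ℕ} {P : V → Set} where

    length : ∀ {x y} → LayeredPath h P x y → ℕ
    length ε       = 0
    length (_ ◅ s) = suc (length s)

    vertexAt : ∀ {x y} (s : LayeredPath h P x y) → Fin (suc (length s)) → V
    vertexAt {x} _       zero    = x
    vertexAt     (_ ◅ s) (suc i) = vertexAt s i

    vertexAt-height : ∀ {x y} (s : LayeredPath h P x y) i → h (vertexAt s i) ≡ toℕ i + h x
    vertexAt-height _ zero = refl
    vertexAt-height {x} (r ◅ s) (suc i) = begin
      h (vertexAt s i)   ≡⟨ vertexAt-height s i ⟩
      toℕ i + h _        ≡⟨ cong (_+_ (toℕ i)) (Rise.height r) ⟩
      toℕ i + suc (h x)  ≡⟨ ℕ.+-suc (toℕ i) (h x) ⟩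
      suc (toℕ i + h x)  ∎
      where open ≡-Reasoning

    vertexAt-last : ∀ {x y} (s : LayeredPath h P x y) → vertexAt s (fromℕ (length s)) ≡ y
    vertexAt-last ε       = refl
    vertexAt-last (_ ◅ s) = vertexAt-last s

    vertexAt-arc : ∀ {x y} (s : LayeredPath h P x y) i →
                   Arc D (vertexAt s (inject₁ i)) (vertexAt s (suc i))
    vertexAt-arc (r ◅ s) zero    = Rise.arc r
    vertexAt-arc (_ ◅ s) (suc i) = vertexAt-arc s i

    length-height : ∀ {x y} (s : LayeredPath h P x y) → length s + h x ≡ h y
    length-height {x} s = begin
      length s + h x                     ≡⟨ cong (_+ h x) (toℕ-fromℕ (length s)) ⟨
      toℕ (fromℕ (length s)) + h x       ≡⟨ vertexAt-height s (fromℕ (length s)) ⟨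
      h (vertexAt s (fromℕ (length s)))  ≡⟨ cong h (vertexAt-last s) ⟩
      h _                                ∎
      where open ≡-Reasoning

    closeUp : ∀ {x y} (s : LayeredPath h P x y) → Arc D y x → HasCycleOfLength D (suc (length s))
    closeUp ε           y→x = ⊥-elim (loopless D _ y→x)
    closeUp s@(_ ◅ _) y→x = length s , refl , record
      { vtx      = vertexAt s
      ; nontriv  = s≤s z≤n
      ; distinct = λ {i} {j} eq → toℕ-injective (ℕ.+-cancelʳ-≡ _ (toℕ i) (toℕ j)
                     (trans (sym (vertexAt-height s i)) (trans (cong h eq) (vertexAt-height s j))))
      ; step     = vertexAt-arc s
      ; close    = subst (λ z → Arc D z _) (sym (vertexAt-last s)) y→x
      }

  module _ {h h′ : V → ℕ} {P P′ : V → Set} where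

    mapPath : (∀ {v} → P v → P′ v) → (∀ {v} → P v → h′ v ≡ h v) →
              ∀ {x y} → LayeredPath h P x y → LayeredPath h′ P′ x y
    mapPath f agree = Star.map λ (rise px py a e) →
      rise (f px) (f py) a (trans (agree py) (trans e (cong suc (sym (agree px)))))

  HasBackArc : (V → ℕ) → (V → Set) → ∀ {m} → DirectedCycle D m → Set
  HasBackArc h P C = ∃₂ λ i j → Arc D (vtx C i) (vtx C j) × LayeredPath h P (vtx C j) (vtx C i)

  mapBackArc : ∀ {h h′ P P′ m} {C : DirectedCycle D m} →
               (∀ {v} → P v → P′ v) → (∀ {v} → P v → h′ v ≡ h v) →
               HasBackArc h P C → HasBackArc h′ P′ C
  mapBackArc f agree (i , j , a , s) = i , j , a , mapPath f agree s

  prev : ∀ {m} → Fin (suc m) → Fin (suc m)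
  prev {m} zero = fromℕ m
  prev (suc i)  = inject₁ i

  arc-prev : ∀ {m} (C : DirectedCycle D m) i → Arc D (vtx C (prev i)) (vtx C i)
  arc-prev C zero    = close C
  arc-prev C (suc i) = step C i

  spread : ∀ {m} (C : DirectedCycle D m) (Q : V → Set) →
           (∀ {i j} → Arc D (vtx C i) (vtx C j) → Q (vtx C i) → Q (vtx C j)) →
           ∀ {i} → Q (vtx C i) → ∀ j → Q (vtx C j)
  spread C Q along {i} q = propagate-from-zero Q (vtx C) next
    (along (close C) (propagate-to-last Q (vtx C) next i q))
    where
    next : ∀ j → Q (vtx C (inject₁ j)) → Q (vtx C (suc j))
    next j = along (step C j)

  Visited : Subset (n D) → Subset (n D) → V → Set
  Visited U U′ v = v ∈ U × v ∉ U′

  visited-⊆ʳ : ∀ {U U₁ U₂ v} → U₂ ⊆ U₁ → Visited U U₁ v → Visited U U₂ v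
  visited-⊆ʳ U₂⊆U₁ (v∈ , v∉) = v∈ , v∉ ∘ U₂⊆U₁

  visited-⊆ˡ : ∀ {U U₁ U₂ v} → U₁ ⊆ U → Visited U₁ U₂ v → Visited U U₂ v
  visited-⊆ˡ U₁⊆U (v∈ , v∉) = U₁⊆U v∈ , v∉

  visited-split : ∀ {U U₂ v} U₁ → Visited U U₂ v → Visited U U₁ v ⊎ Visited U₁ U₂ v
  visited-split {v = v} U₁ (v∈ , v∉) with v ∈? U₁
  ... | yes v∈₁ = inj₂ (v∈₁ , v∉)
  ... | no  v∉₁ = inj₁ (v∈ , v∉₁)

  -- A search that starts with unvisited vertices U and heights h₀, and ends with U′ still unvisited.
  record Search (U U′ : Subset (n D)) (h₀ h : V → ℕ) : Set where
    field
      shrinks   : U′ ⊆ U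
      unchanged : ∀ {v} → ¬ Visited U U′ v → h v ≡ h₀ v
      closed    : ∀ {a b} → Visited U U′ a → b ∈ U → Arc D a b → b ∉ U′
      backArc   : ∀ {m} (C : DirectedCycle D m) → (∀ i → Visited U U′ (vtx C i)) →
                  HasBackArc h (Visited U U′) C

  search-refl : ∀ {U h} → Search U U h h
  search-refl = record
    { shrinks   = λ v∈ → v∈
    ; unchanged = λ _ → refl
    ; closed    = λ (a∈ , a∉) → contradiction a∈ a∉
    ; backArc   = λ C visited → contradiction (proj₁ (visited zero)) (proj₂ (visited zero))
    }

  search-trans : ∀ {U U₁ U₂ h₀ h₁ h₂} → Search U U₁ h₀ h₁ → Search U₁ U₂ h₁ h₂ → Search U U₂ h₀ h₂
  search-trans {U} {U₁} {U₂} {h₀} {h₁} {h₂} S T = record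
    { shrinks   = S.shrinks ∘ T.shrinks
    ; unchanged = λ unvisited → trans (T.unchanged (unvisited ∘ second)) (S.unchanged (unvisited ∘ first))
    ; closed    = closed
    ; backArc   = backArc
    }
    where
    module S = Search S
    module T = Search T
    first : ∀ {v} → Visited U U₁ v → Visited U U₂ v
    first = visited-⊆ʳ T.shrinks
    second : ∀ {v} → Visited U₁ U₂ v → Visited U U₂ v
    second = visited-⊆ˡ S.shrinks
    closed : ∀ {a b} → Visited U U₂ a → b ∈ U → Arc D a b → b ∉ U₂
    closed {b = b} va b∈ a→b with visited-split U₁ va | b ∈? U₁
    ... | inj₁ va₁ | _       = S.closed va₁ b∈ a→b ∘ T.shrinks
    ... | inj₂ va₂ | yes b∈₁ = T.closed va₂ b∈₁ a→b
    ... | inj₂ _   | no  b∉₁ = b∉₁ ∘ T.shrinks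
    backArc : ∀ {m} (C : DirectedCycle D m) → (∀ i → Visited U U₂ (vtx C i)) →
              HasBackArc h₂ (Visited U U₂) C
    backArc C visited with all? (λ i → vtx C i ∈? U₁)
    ... | yes all∈₁ = mapBackArc {C = C} second (λ _ → refl) (T.backArc C λ i → all∈₁ i , proj₂ (visited i))
    ... | no ¬all∈₁ = mapBackArc {C = C} first (λ (_ , v∉₁) → T.unchanged (v∉₁ ∘ proj₁))
                        (S.backArc C λ i → proj₁ (visited i) , all∉₁ i)
      where
      -- S closes U ∖ U₁ under arcs, so a cycle with one vertex outside U₁ has all of them outside.
      all∉₁ : ∀ i → vtx C i ∉ U₁
      all∉₁ = let (i , i∉) = ¬∀⟶∃¬ _ _ (λ i → vtx C i ∈? U₁) ¬all∈₁ in
        spread C (_∉ U₁) (λ {i} {j} a v∉ → S.closed (proj₁ (visited i) , v∉) (proj₁ (visited j)) a) i∉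

  record Visit (U : Subset (n D)) (r : V) (h₀ : V → ℕ) (d : ℕ) : Set where
    field
      rest        : Subset (n D)
      heights     : V → ℕ
      search      : Search U rest h₀ heights
      root        : r ∉ rest
      root-height : heights r ≡ d
      tree        : ∀ {v} → Visited U rest v → LayeredPath heights (Visited U rest) r v

  -- The searches from those out-neighbours of r listed in xs, run one after the other.
  record VisitFrom (r : V) (U : Subset (n D)) (h₀ : V → ℕ) (xs : List V) : Set where
    field
      rest    : Subset (n D)
      heights : V → ℕ
      search  : Search U rest h₀ heights
      tree    : ∀ {v} → Visited U rest v → ∃ λ x → Arc D r x × heights x ≡ suc (heights r) ×
                Visited U rest x × LayeredPath heights (Visited U rest) x v
      covers  : ∀ {x} → x List.∈ xs → Arc D r x → x ∉ rest

  visitFrom-nil : ∀ {r U h₀} → VisitFrom r U h₀ []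
  visitFrom-nil {U = U} {h₀} = record
    { rest    = U
    ; heights = h₀
    ; search  = search-refl
    ; tree    = λ (v∈ , v∉) → contradiction v∈ v∉
    ; covers  = λ ()
    }

  visitFrom-skip : ∀ {r U h₀ x xs} → (Arc D r x → x ∉ U) → VisitFrom r U h₀ xs → VisitFrom r U h₀ (x ∷ xs)
  visitFrom-skip {r} {x = x} {xs} skip L = record { VisitFrom L ; covers = covers }
    where
    open VisitFrom L using (rest; search)
    covers : ∀ {y} → y List.∈ x ∷ xs → Arc D r y → y ∉ rest
    covers (here refl) r→x = skip r→x ∘ Search.shrinks search
    covers (there y∈)  r→y = VisitFrom.covers L y∈ r→y

  visitFrom-cons : ∀ {r U h₀ x xs} → r ∉ U → Arc D r x → x ∈ U → (T : Visit U x h₀ (suc (h₀ r))) →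
                   VisitFrom r (Visit.rest T) (Visit.heights T) xs → VisitFrom r U h₀ (x ∷ xs)
  visitFrom-cons {r} {U} {h₀} {x} {xs} r∉ r→x x∈ T L = record
    { rest    = L.rest
    ; heights = L.heights
    ; search  = search-trans T.search L.search
    ; tree    = tree
    ; covers  = covers
    }
    where
    module T = Visit T
    module L = VisitFrom L
    unchanged : ∀ {v} → Visited U T.rest v → L.heights v ≡ T.heights v
    unchanged (_ , v∉) = Search.unchanged L.search (v∉ ∘ proj₁)
    x-height : L.heights x ≡ suc (L.heights r)
    x-height = begin
      L.heights x          ≡⟨ unchanged (x∈ , T.root) ⟩
      T.heights x          ≡⟨ T.root-height ⟩
      suc (h₀ r)           ≡⟨ cong suc (Search.unchanged (search-trans T.search L.search) (r∉ ∘ proj₁)) ⟨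
      suc (L.heights r)    ∎
      where open ≡-Reasoning
    tree : ∀ {v} → Visited U L.rest v → ∃ λ y → Arc D r y × L.heights y ≡ suc (L.heights r) ×
           Visited U L.rest y × LayeredPath L.heights (Visited U L.rest) y v
    tree v-visited with visited-split T.rest v-visited
    ... | inj₁ vT = x , r→x , x-height , byT (x∈ , T.root) , mapPath byT unchanged (T.tree vT)
      where
      byT : ∀ {v} → Visited U T.rest v → Visited U L.rest v
      byT = visited-⊆ʳ (Search.shrinks L.search)
    ... | inj₂ vL = let (y , r→y , y-height , yL , s) = L.tree vL in
                    y , r→y , y-height , byL yL , mapPath byL (λ _ → refl) s
      where
      byL : ∀ {v} → Visited T.rest L.rest v → Visited U L.rest v
      byL = visited-⊆ˡ (Search.shrinks T.search)
    covers : ∀ {y} → y List.∈ x ∷ xs → Arc D r y → y ∉ L.rest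
    covers (here refl) _   = T.root ∘ Search.shrinks L.search
    covers (there y∈)  r→y = L.covers y∈ r→y

  visit-step : ∀ {U r h₀ d} → r ∈ U → VisitFrom r (U - r) (updateAt h₀ r (λ _ → d)) (allFin (n D)) →
               Visit U r h₀ d
  visit-step {U} {r} {h₀} {d} r∈ L = record
    { rest        = L.rest
    ; heights     = L.heights
    ; search      = record
      { shrinks   = p─q⊆p U ⁅ r ⁆ ∘ S.shrinks
      ; unchanged = unchanged
      ; closed    = closed
      ; backArc   = backArc
      }
    ; root        = root
    ; root-height = trans (S.unchanged (x∉p-x U r ∘ proj₁)) (updateAt-updates r h₀)
    ; tree        = tree
    }
    where
    module L = VisitFrom L
    module S = Search L.search
    root : r ∉ L.rest
    root = x∉p-x U r ∘ S.shrinks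
    mark : ∀ {v} → Visited (U - r) L.rest v → Visited U L.rest v
    mark = visited-⊆ˡ (p─q⊆p U ⁅ r ⁆)
    unmark : ∀ {v} → Visited U L.rest v → v ≢ r → Visited (U - r) L.rest v
    unmark (v∈ , v∉) v≢r = x∈p∧x≢y⇒x∈p-y v∈ v≢r , v∉
    unchanged : ∀ {v} → ¬ Visited U L.rest v → L.heights v ≡ h₀ v
    unchanged {v} unvisited with v ≟ r
    ... | yes refl = contradiction (r∈ , root) unvisited
    ... | no  v≢r  = trans (S.unchanged (unvisited ∘ mark)) (updateAt-minimal v r h₀ v≢r)
    closed : ∀ {a b} → Visited U L.rest a → b ∈ U → Arc D a b → b ∉ L.rest
    closed {a} {b} va b∈ a→b with a ≟ r | b ≟ r
    ... | yes refl | _        = L.covers (∈-allFin b) a→b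
    ... | no  _    | yes refl = root
    ... | no  a≢r  | no  b≢r  = S.closed (unmark va a≢r) (x∈p∧x≢y⇒x∈p-y b∈ b≢r) a→b
    tree : ∀ {v} → Visited U L.rest v → LayeredPath L.heights (Visited U L.rest) r v
    tree {v} vv with v ≟ r
    ... | yes refl = ε
    ... | no  v≢r  with L.tree (unmark vv v≢r)
    ...   | x , r→x , x-height , vx , s = rise (r∈ , root) (mark vx) r→x x-height ◅ mapPath mark (λ _ → refl) s
    backArc : ∀ {m} (C : DirectedCycle D m) → (∀ i → Visited U L.rest (vtx C i)) →
              HasBackArc L.heights (Visited U L.rest) C
    -- A cycle through r is closed by the arc into r from its predecessor, a descendant of r.
    backArc C visited with any? (λ i → vtx C i ≟ r)
    ... | yes (i , refl) = prev i , i , arc-prev C i , tree (visited (prev i))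
    ... | no  r∉C        = mapBackArc {C = C} mark (λ _ → refl) (S.backArc C λ i → unmark (visited i) (r∉C ∘ (i ,_)))

  mutual
    visit : ∀ N {U} → ∣ U ∣ ≤ N → ∀ {r} → r ∈ U → ∀ h₀ d → Visit U r h₀ d
    visit zero    b r∈ _ _ = contradiction (ℕ.<-≤-trans (x∈p⇒∣p-x∣<∣p∣ r∈) b) ℕ.n≮0
    visit (suc N) {U} b {r} r∈ h₀ d = visit-step r∈
      (visitFrom N r (U - r) (ℕ.≤-pred (ℕ.<-≤-trans (x∈p⇒∣p-x∣<∣p∣ r∈) b)) (x∉p-x U r) _ (allFin (n D)))

    visitFrom : ∀ N r U → ∣ U ∣ ≤ N → r ∉ U → ∀ h₀ xs → VisitFrom r U h₀ xs
    visitFrom N r U b r∉ h₀ []       = visitFrom-nil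
    visitFrom N r U b r∉ h₀ (x ∷ xs) with arc? D r x | x ∈? U
    ... | yes r→x | yes x∈ = visitFrom-cons r∉ r→x x∈ T
          (visitFrom N r rest (ℕ.≤-trans (p⊆q⇒∣p∣≤∣q∣ (Search.shrinks search)) b) (r∉ ∘ Search.shrinks search) heights xs)
      where
      T : Visit U x h₀ (suc (h₀ r))
      T = visit N b x∈ h₀ (suc (h₀ r))
      open Visit T
    ... | yes _   | no  x∉ = visitFrom-skip (λ _ → x∉) (visitFrom N r U b r∉ h₀ xs)
    ... | no ¬r→x | _      = visitFrom-skip (λ r→x → contradiction r→x ¬r→x) (visitFrom N r U b r∉ h₀ xs)

  backArcs : StronglyConnected D → V → Σ (V → ℕ) λ h → ∀ {m} (C : DirectedCycle D m) → HasBackArc h (λ _ → Unit) C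
  backArcs strong r = heights , λ C →
    mapBackArc {C = C} _ (λ _ → refl) (backArc C λ i → reached (strong r (vtx C i)) (∈⊤ , root))
    where
    open Visit (visit ∣ ⊤ {n D} ∣ ℕ.≤-refl (∈⊤ {x = r}) (λ _ → 0) 0)
    open Search search
    reached : ∀ {a v} → Star (Arc D) a v → Visited ⊤ rest a → Visited ⊤ rest v
    reached ε         va = va
    reached (a→b ◅ s) va = reached s (∈⊤ , closed va ∈⊤ a→b)

  acyclic-blockColouring : ∀ p c .{{_ : NonZero p}} .{{_ : NonZero (c * p)}} (h : V → ℕ) {P : V → Set} →
    (∀ {m} (C : DirectedCycle D m) → HasBackArc h P C) →
    (∀ ℓ (r : ℤ) → + 2 ℤ.- + p ℤ.≤ r → r ℤ.≤ + p → HasCycleOfLength D ℓ → ¬ CongMod (c * p) ℓ r) →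
    ∀ j → Acyclic D (λ v → block p c (h v) ≡ j)
  acyclic-blockColouring p c h hasBackArc noCongruentCycle j m C monochromatic with hasBackArc C
  ... | i , i′ , u→w , s =
    let (r , lower , upper , congruent) = sameBlock⇒congMod p c (length s) (h (vtx C i′)) sameBlock
    in noCongruentCycle (suc (length s)) r lower upper (closeUp s u→w) congruent
    where
    sameBlock : block p c (length s + h (vtx C i′)) ≡ block p c (h (vtx C i′))
    sameBlock = trans (cong (block p c) (length-height s)) (trans (monochromatic i) (sym (monochromatic i′)))

theorem4 : (D : Digraph) (g k p : ℕ) →
    StronglyConnected D → IsGirth D g →
    g ∸ 1 ≤ k → p ≤ g ∸ 1 → 1 ≤ p →
    (∀ ℓ (r : ℤ) → (+ 2) ℤ.- (+ p) ℤ.≤ r → r ℤ.≤ + p →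
       HasCycleOfLength D ℓ → ¬ CongMod (ceilDiv k p * p) ℓ r) →
    DichromaticAtMost D (ceilDiv k p)
theorem4 D g k p strong ((_ , _ , C₀) , _) g∸1≤k p≤g∸1 1≤p noCongruentCycle =
  colouring (backArcs strong (DirectedCycle.vtx C₀ zero))
  where
  open DepthFirst D
  c : ℕ
  c = ceilDiv k p
  instance
    p≢0 : NonZero p
    p≢0 = >-nonZero 1≤p
    -- The girth enters only through p ≤ g − 1 ≤ k, which makes the number of colours positive.
    c≢0 : NonZero c
    c≢0 = ceilDiv-nonZero 1≤p (ℕ.≤-trans p≤g∸1 g∸1≤k)
    cp≢0 : NonZero (c * p)
    cp≢0 = ℕ.m*n≢0 c p
  colouring : Σ (V → ℕ) (λ h → ∀ {m} (C : DirectedCycle D m) → HasBackArc h (λ _ → Unit) C) →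
              DichromaticAtMost D c
  colouring (h , hasBackArc) =
    (λ v → block p c (h v)) , acyclic-blockColouring p c h hasBackArc noCongruentCycle
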